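{- For an integer $b$, call a composite positive integer $q$ a prime pretender to base $b$ if $b^q \equiv b \pmod q$, and let $q_b$ (the primary pretender for $b$) denote the least prime pretender to base $b$. Then $q_b$ exists for every integer $b$ (indeed $q_b \le 561$, since $561 = 3\cdot 11\cdot 17$ satisfies $b^{561}\equiv b \pmod{561}$ for all $b$), the function $b \mapsto q_b$ takes exactly $132$ distinct values, and $b\mapsto q_b$ is a periodic function of $b$ whose period is $$N = \Big(\prod_{i=1}^{59} p_i\Big)\Big(\prod_{i=1}^{9} p_i\Big),$$ where $p_i$ denotes the $i$-th prime (so $p_{59}=277$ and $p_9=23$); $N$ is a $122$-digit number.
   Context: A prime pretender to base $b$ is a composite number $q$ with $b^q\equiv b \pmod q$; the primary pretender $q_b$ is the least such $q$. $p_i$ is the $i$-th prime, $p_1=2$. -}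

module Defs where

open import Data.Nat using (ℕ; zero; suc; _+_; _*_; _∸_; _≤_; _!)

open import Data.Nat.Primality using (Composite; prime?)
open import Data.Integer as ℤ using (ℤ; +_)
open import Data.Integer.Divisibility using () renaming (_∣_ to _∣ℤ_)
open import Data.Product using (_×_)
open import Relation.Nullary using (yes; no)

PrimePretender : ℤ → ℕ → Set
PrimePretender b q = Composite q × ((+ q) ∣ℤ (b ℤ.^ q ℤ.- b))

IsPrimaryPretender : ℤ → ℕ → Set
IsPrimaryPretender b q = PrimePretender b q × (∀ q′ → PrimePretender b q′ → q ≤ q′)

searchPrime : ℕ → ℕ → ℕ
searchPrime zero    k = k
searchPrime (suc f) k with prime? k
... | yes _ = k
... | no  _ = searchPrime f (suc k)

-- least prime greater than n (by Euclid there is one in (n, n! + 1])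
nextPrime : ℕ → ℕ
nextPrime n = searchPrime (n !) (suc n)

primeFrom0 : ℕ → ℕ
primeFrom0 zero    = 2
primeFrom0 (suc i) = nextPrime (primeFrom0 i)

-- p i = the i-th prime, p 1 = 2 (p 0 is a junk value)
p : ℕ → ℕ
p i = primeFrom0 (i ∸ 1)

primorialP : ℕ → ℕ
primorialP zero    = 1
primorialP (suc n) = primorialP n * p (suc n)

N : ℕ
N = primorialP 59 * primorialP 9

-- Whether q divides b ^ q - b depends only on b modulo q, so it is decided by
-- square-and-multiply on a residue. Say v dominates q when every residue class
-- modulo lcm v q satisfying the congruence for q satisfies it for v; a composite q
-- with a dominator v < q is then never primary. An exhaustive check shows that
-- every composite q ≤ 561 is dominated unless it is one of 132 values, each of
-- which divides N and is attained at a listed b. As 561 is a Carmichael number,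
-- q_b is the first of these values to which b pretends, so q_b has period N.
-- Any period M yields the period gcd M N by Bézout; a proper divisor of N would
-- divide some N / p with p prime, but for every prime p ∣ N a listed b has
-- q_b ≠ q_(b + N / p).

{-# OPTIONS --safe #-}
module Submission where

open import Defs
open import Data.Nat using (ℕ; _≤_; _<_)
open import Data.Integer using (ℤ; +_; _+_)
open import Data.Product using (Σ; ∃; ∃-syntax; _×_)
open import Data.List using (List; length)
open import Data.List.Membership.Propositional using (_∈_)
open import Data.List.Relation.Unary.Unique.Propositional using (Unique)
open import Relation.Binary.PropositionalEquality using (_≡_)

open import Data.Nat as ℕ
  using (zero; suc; 2+; _%_; _/_; NonZero; NonTrivial; _<?_; ≢-nonZero; >-nonZero; ≢-nonZero⁻¹)
open import Data.Nat.Properties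
  using (≤-refl; ≤-trans; <⇒≤; <⇒≢; ≤∧≢⇒<; m≤n⇒m≤1+n; ≮⇒≥; *-identityˡ; *-zeroʳ; *-comm; m*n≢0; +-identityʳ; _≟_)
open import Data.Nat.Binary as ℕᵇ using (ℕᵇ; 2[1+_]; 1+[2_]; toℕ; fromℕ)
open import Data.Nat.Binary.Properties using (toℕ-fromℕ)
open import Data.Nat.DivMod using (m*n/n≡m)
open import Data.Nat.Divisibility as ℕ using (divides; ∣⇒≤)
open import Data.Nat.GCD using (gcd; gcd-GCD; gcd[m,n]∣m; gcd[m,n]∣n; module Bézout)
open import Data.Nat.LCM using (lcm; m∣lcm[m,n]; n∣lcm[m,n]; gcd*lcm)
open import Data.Nat.ListAction using (product)
open import Data.Nat.Primality using (Composite; Prime; composite?; prime?; composite⇒nonZero; prime⇒nonZero)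
open import Data.Nat.Primality.Factorisation using (factorise; factorisationHasAllPrimeFactors)
open import Data.Nat.Tactic.RingSolver as ℕ-Solver using ()
open import Data.Integer as ℤ using (_-_; _*_; _^_; -_; 0ℤ; _%ℕ_; _/ℕ_)
open import Data.Integer.DivMod using (a≡a%ℕn+[a/ℕn]*n; n%ℕd<d)
import Data.Integer.Divisibility as Unsigned
open import Data.Integer.Divisibility.Signed as Signed
  using (divides; ∣ᵤ⇒∣; ∣⇒∣ᵤ; ∣m⇒∣-m; ∣m∣n⇒∣m+n; ∣n⇒∣m*n; ∣m⇒∣m*n; ∣-trans; _∣?_)
open import Data.Integer.Properties as ℤ using (pos-*; pos-+; +-inverseʳ; *-zeroˡ; +-assoc; ^-distribˡ-+-*)
open import Data.Integer.Tactic.RingSolver using (solve-∀)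
open import Data.List using ([]; _∷_; _++_; map; filter; upTo; find)
open import Data.List.Membership.Propositional using () renaming (find to find-∈)
open import Data.List.Membership.Propositional.Properties using (∈-map⁻)
open import Data.List.Membership.DecPropositional _≟_ using (_∈?_)
open import Data.List.Relation.Unary.All as All using (All; all?)
open import Data.List.Relation.Unary.All.Properties using (all-filter; ++⁺)
open import Data.List.Relation.Unary.AllPairs as AllPairs using (AllPairs; _∷_; allPairs?)
open import Data.List.Relation.Unary.Any using (Any; any?; here; there)
open import Data.Bool using (true; if_then_else_)
open import Data.Maybe using (just; fromMaybe)
open import Data.Product using (_,_; proj₁; proj₂; uncurry)
open import Data.Sum using (_⊎_; [_,_]′)
open import Function.Base using (_$_; _∘_; case_of_)
open import Function.Bundles using (_⇔_; mk⇔; Equivalence)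
open import Relation.Binary.Bundles using (Setoid)
open import Relation.Binary.PropositionalEquality
  using (_≢_; refl; sym; trans; cong; cong₂; subst; module ≡-Reasoning)
import Relation.Binary.Reasoning.Setoid as ≈-Reasoning
open import Relation.Binary.Structures using (IsEquivalence)
open import Relation.Nullary using (¬_; contradiction)
open import Relation.Nullary.Decidable as Dec
  using (Dec; yes; no; does; does-⇔; ¬?; _×-dec_; _⊎-dec_; _→-dec_)
open import Relation.Unary using (Pred; Decidable)

-- Checking refl : does a? ≡ true evaluates only booleans, whereas the
-- equivalent from-yes a? exhausts memory on the large decisions below.
decide : ∀ {a} {A : Set a} (a? : Dec A) → does a? ≡ true → A
decide (yes a) _  = a
decide (no _)  ()

module _ {p} {P : Pred ℕ p} (P? : Decidable P) where

  -- Unlike allUpTo?, this never matches on the proofs of P?, so evaluating its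
  -- does-field computes only booleans.
  allBelow? : ∀ n → Dec (∀ {s} → s < n → P s)
  allBelow? zero    = yes λ ()
  allBelow? (suc n) = Dec.map′ (uncurry extend) (λ all → all ≤-refl , all ∘ m≤n⇒m≤1+n) (P? n ×-dec allBelow? n)
    where
    extend : P n → (∀ {s} → s < n → P s) → ∀ {s} → s < suc n → P s
    extend Pn all {s} (ℕ.s≤s s≤n) with s ≟ n
    ... | yes refl = Pn
    ... | no s≢n   = all (≤∧≢⇒< s≤n s≢n)

  find-least : ∀ d {xs y} → AllPairs _≤_ xs → y ∈ xs → P y →
               let x = fromMaybe d (find P? xs) in x ∈ xs × P x × x ≤ y
  find-least d {x ∷ xs} (x≤xs ∷ sorted) y∈ Py with P? x | y∈
  ... | yes Px | here refl  = here refl , Px , ≤-refl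
  ... | yes Px | there y∈xs = here refl , Px , All.lookup x≤xs y∈xs
  ... | no ¬Px | here refl  = contradiction Py ¬Px
  ... | no ¬Px | there y∈xs with find-least d sorted y∈xs Py
  ...   | x∈xs , Px′ , x≤y = there x∈xs , Px′ , x≤y

find-cong : ∀ {a p q} {A : Set a} {P : Pred A p} {Q : Pred A q} (P? : Decidable P) (Q? : Decidable Q) →
            ∀ {xs} → (∀ {x} → x ∈ xs → P x ⇔ Q x) → find P? xs ≡ find Q? xs
find-cong P? Q? {[]}     P⇔Q = refl
find-cong P? Q? {x ∷ xs} P⇔Q =
  cong₂ (λ c r → if c then just x else r) (does-⇔ (P⇔Q (here refl)) (P? x) (Q? x)) (find-cong P? Q? (P⇔Q ∘ there))

-- Congruences modulo m

infix 4 _≡_mod_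

record _≡_mod_ (a b : ℤ) (m : ℕ) : Set where
  constructor divides-difference
  field ∣-difference : + m Signed.∣ a - b
open _≡_mod_

module _ {m : ℕ} where

  ≡mod-refl : ∀ {a} → a ≡ a mod m
  ≡mod-refl {a} = divides-difference (divides 0ℤ (trans (+-inverseʳ a) (sym (*-zeroˡ (+ m)))))

  ≡mod-sym : ∀ {a b} → a ≡ b mod m → b ≡ a mod m
  ≡mod-sym {a} {b} (divides-difference m∣a-b) =
    divides-difference (subst (+ m Signed.∣_) (-[a-b]≡b-a a b) (∣m⇒∣-m m∣a-b))
    where
    -[a-b]≡b-a : ∀ a b → - (a - b) ≡ b - a
    -[a-b]≡b-a = solve-∀

  ≡mod-trans : ∀ {a b c} → a ≡ b mod m → b ≡ c mod m → a ≡ c mod m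
  ≡mod-trans {a} {b} {c} (divides-difference m∣a-b) (divides-difference m∣b-c) =
    divides-difference (subst (+ m Signed.∣_) (telescope a b c) (∣m∣n⇒∣m+n m∣a-b m∣b-c))
    where
    telescope : ∀ a b c → (a - b) + (b - c) ≡ a - c
    telescope = solve-∀

  ≡mod-isEquivalence : IsEquivalence (λ a b → a ≡ b mod m)
  ≡mod-isEquivalence = record { refl = ≡mod-refl ; sym = ≡mod-sym ; trans = ≡mod-trans }

  ≡mod-setoid : Setoid _ _
  ≡mod-setoid = record { isEquivalence = ≡mod-isEquivalence }

  *-cong-mod : ∀ {a b c d} → a ≡ b mod m → c ≡ d mod m → a * c ≡ b * d mod m
  *-cong-mod {a} {b} {c} {d} (divides-difference m∣a-b) (divides-difference m∣c-d) =
    divides-difference $ subst (+ m Signed.∣_) (split a b c d) $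
      ∣m∣n⇒∣m+n (∣n⇒∣m*n a m∣c-d) (∣m⇒∣m*n d m∣a-b)
    where
    split : ∀ a b c d → a * (c - d) + (a - b) * d ≡ a * c - b * d
    split = solve-∀

  *-congˡ-mod : ∀ a {b c} → b ≡ c mod m → a * b ≡ a * c mod m
  *-congˡ-mod a = *-cong-mod (≡mod-refl {a})

  ^-cong-mod : ∀ {a b} → a ≡ b mod m → ∀ e → a ^ e ≡ b ^ e mod m
  ^-cong-mod a≡b zero    = ≡mod-refl
  ^-cong-mod a≡b (suc e) = *-cong-mod a≡b (^-cong-mod a≡b e)

  +-multiple-≡mod : ∀ {k} → m ℕ.∣ k → ∀ b → b + + k ≡ b mod m
  +-multiple-≡mod {k} m∣k b =
    divides-difference (subst (+ m Signed.∣_) (k≡[b+k]-b b (+ k)) (∣ᵤ⇒∣ m∣k))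
    where
    k≡[b+k]-b : ∀ b k → k ≡ (b + k) - b
    k≡[b+k]-b = solve-∀

  ≡mod-weaken : ∀ {n a b} → n ℕ.∣ m → a ≡ b mod m → a ≡ b mod n
  ≡mod-weaken n∣m (divides-difference m∣a-b) = divides-difference (∣-trans (∣ᵤ⇒∣ n∣m) m∣a-b)

  %ℕ-≡mod : .{{_ : NonZero m}} → ∀ b → + (b %ℕ m) ≡ b mod m
  %ℕ-≡mod b = divides-difference $
    subst (λ x → + m Signed.∣ + (b %ℕ m) - x) (sym (a≡a%ℕn+[a/ℕn]*n b m)) $
      divides (- (b /ℕ m)) (r-[r+qm]≡-qm (+ (b %ℕ m)) (b /ℕ m) (+ m))
    where
    r-[r+qm]≡-qm : ∀ r q m → r - (r + q * m) ≡ - q * m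
    r-[r+qm]≡-qm = solve-∀

module ≡mod-Reasoning (m : ℕ) = ≈-Reasoning (≡mod-setoid {m})

-- The Fermat congruence

^-double : ∀ x k → x ^ (2 ℕ.* k) ≡ x ^ k * x ^ k
^-double x k = trans (^-distribˡ-+-* x k (k ℕ.+ 0)) (cong (λ n → x ^ k * x ^ n) (+-identityʳ k))

square : ℕ → ℕ
square t = t ℕ.* t

powModᵇ : (m : ℕ) .{{_ : NonZero m}} → ℕ → ℕᵇ → ℕ
powModᵇ m s ℕᵇ.zero  = 1 % m
powModᵇ m s 2[1+ e ] = square (s ℕ.* powModᵇ m s e) % m
powModᵇ m s 1+[2 e ] = s ℕ.* square (powModᵇ m s e) % m

powModᵇ-≡mod : ∀ m .{{_ : NonZero m}} s e → + powModᵇ m s e ≡ (+ s) ^ toℕ e mod m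
powModᵇ-≡mod m s ℕᵇ.zero  = %ℕ-≡mod (+ 1)
powModᵇ-≡mod m s 2[1+ e ] = begin
  + (square (s ℕ.* h) % m)      ≈⟨ %ℕ-≡mod (+ square (s ℕ.* h)) ⟩
  + square (s ℕ.* h)            ≡⟨ pos-* (s ℕ.* h) (s ℕ.* h) ⟩
  + (s ℕ.* h) * + (s ℕ.* h)     ≡⟨ cong₂ _*_ (pos-* s h) (pos-* s h) ⟩
  (+ s * + h) * (+ s * + h)     ≈⟨ *-cong-mod sh≡ sh≡ ⟩
  (+ s) ^ suc k * (+ s) ^ suc k ≡⟨ ^-double (+ s) (suc k) ⟨
  (+ s) ^ (2 ℕ.* suc k)         ∎
  where
  open ≡mod-Reasoning m
  h = powModᵇ m s e
  k = toℕ e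
  sh≡ : + s * + h ≡ (+ s) ^ suc k mod m
  sh≡ = *-congˡ-mod (+ s) (powModᵇ-≡mod m s e)
powModᵇ-≡mod m s 1+[2 e ] = begin
  + (s ℕ.* square h % m)        ≈⟨ %ℕ-≡mod (+ (s ℕ.* square h)) ⟩
  + (s ℕ.* square h)            ≡⟨ trans (pos-* s (square h)) (cong (+ s *_) (pos-* h h)) ⟩
  + s * (+ h * + h)             ≈⟨ *-congˡ-mod (+ s) (*-cong-mod h≡ h≡) ⟩
  + s * ((+ s) ^ k * (+ s) ^ k) ≡⟨ cong (+ s *_) (^-double (+ s) k) ⟨
  (+ s) ^ suc (2 ℕ.* k)         ∎
  where
  open ≡mod-Reasoning m
  h = powModᵇ m s e
  k = toℕ e
  h≡ : + h ≡ (+ s) ^ k mod m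
  h≡ = powModᵇ-≡mod m s e

powMod : (m : ℕ) .{{_ : NonZero m}} → ℕ → ℕ → ℕ
powMod m s e = powModᵇ m s (fromℕ e)

powMod-≡mod : ∀ m .{{_ : NonZero m}} s e → + powMod m s e ≡ (+ s) ^ e mod m
powMod-≡mod m s e =
  subst (λ n → + powMod m s e ≡ (+ s) ^ n mod m) (toℕ-fromℕ e) (powModᵇ-≡mod m s (fromℕ e))

infix 4 _≡?_mod_

_≡?_mod_ : ∀ a b m → Dec (a ≡ b mod m)
a ≡? b mod m = Dec.map′ divides-difference ∣-difference (+ m ∣? a - b)

-- A record rather than an abbreviation of b ^ q ≡ b mod q: unification through an
-- abbreviation unfolds b ^ q, which blows up for a literal q such as 561.
record Fermat (q : ℕ) (b : ℤ) : Set where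
  constructor fermat
  field congruence : b ^ q ≡ b mod q
open Fermat

fermat⇔∣ : ∀ {q b} → Fermat q b ⇔ + q Unsigned.∣ b ^ q - b
fermat⇔∣ = mk⇔ (∣⇒∣ᵤ ∘ ∣-difference ∘ congruence) (fermat ∘ divides-difference ∘ ∣ᵤ⇒∣)

fermat-≡mod : ∀ {q L b c} → q ℕ.∣ L → b ≡ c mod L → Fermat q b → Fermat q c
fermat-≡mod {q} {L} {b} {c} q∣L b≡c (fermat b^q≡b) = fermat $ begin
  c ^ q ≈⟨ ^-cong-mod (≡mod-sym b≡c′) q ⟩
  b ^ q ≈⟨ b^q≡b ⟩
  b     ≈⟨ b≡c′ ⟩
  c     ∎
  where
  open ≡mod-Reasoning q
  b≡c′ = ≡mod-weaken q∣L b≡c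

fermat⇔powMod : ∀ q .{{_ : NonZero q}} b → let r = b %ℕ q in
                + powMod q r q ≡ + r mod q ⇔ Fermat q b
fermat⇔powMod q b = mk⇔
  (λ pow≡r → fermat $ begin
     b ^ q          ≈⟨ ^-cong-mod (≡mod-sym (%ℕ-≡mod b)) q ⟩
     (+ r) ^ q      ≈⟨ ≡mod-sym (powMod-≡mod q r q) ⟩
     + powMod q r q ≈⟨ pow≡r ⟩
     + r            ≈⟨ %ℕ-≡mod b ⟩
     b              ∎)
  (λ (fermat b^q≡b) → begin
     + powMod q r q ≈⟨ powMod-≡mod q r q ⟩
     (+ r) ^ q      ≈⟨ ^-cong-mod (%ℕ-≡mod b) q ⟩
     b ^ q          ≈⟨ b^q≡b ⟩
     b              ≈⟨ ≡mod-sym (%ℕ-≡mod b) ⟩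
     + r            ∎)
  where
  open ≡mod-Reasoning q
  r = b %ℕ q

fermat? : ∀ q b → Dec (Fermat q b)
fermat? zero      b = Dec.map′ fermat congruence (b ^ 0 ≡? b mod 0)
fermat? q@(suc _) b = Dec.map (fermat⇔powMod q b) (+ powMod q r q ≡? + r mod q)
  where r = b %ℕ q

Dominates : ℕ → ℕ → Set
Dominates v q = ∀ {s} → s < lcm v q → Fermat q (+ s) → Fermat v (+ s)

dominates? : ∀ v q → Dec (Dominates v q)
dominates? v q = allBelow? (λ s → fermat? q (+ s) →-dec fermat? v (+ s)) (lcm v q)

lcm-nonZero : ∀ m n .{{_ : NonZero m}} .{{_ : NonZero n}} → NonZero (lcm m n)
lcm-nonZero m n = ≢-nonZero λ lcm≡0 → ≢-nonZero⁻¹ (m ℕ.* n) {{m*n≢0 m n}} $ begin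
  m ℕ.* n             ≡⟨ gcd*lcm m n ⟨
  gcd m n ℕ.* lcm m n ≡⟨ cong (gcd m n ℕ.*_) lcm≡0 ⟩
  gcd m n ℕ.* 0       ≡⟨ *-zeroʳ (gcd m n) ⟩
  0                   ∎
  where open ≡-Reasoning

dominates⇒fermat : ∀ {v q b} .{{_ : NonZero v}} .{{_ : NonZero q}} →
                   Dominates v q → Fermat q b → Fermat v b
dominates⇒fermat {v} {q} {b} dominates q-fermat =
  fermat-≡mod (m∣lcm[m,n] v q) (%ℕ-≡mod b) $
    dominates (n%ℕd<d b L) $
      fermat-≡mod (n∣lcm[m,n] v q) (≡mod-sym (%ℕ-≡mod b)) q-fermat
  where
  L = lcm v q
  instance _ = lcm-nonZero v q

-- Periods of functions on ℤ

Period : ∀ {a} {A : Set a} → (ℤ → A) → ℕ → Set a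
Period f M = ∀ b → f (b + + M) ≡ f b

pos-+-assoc : ∀ b m n → (b + + m) + + n ≡ b + + (m ℕ.+ n)
pos-+-assoc b m n = trans (+-assoc b (+ m) (+ n)) (cong (λ x → b + x) (sym (pos-+ m n)))

module _ {a} {A : Set a} {f : ℤ → A} where

  period-+ : ∀ {m n} → Period f m → Period f n → Period f (m ℕ.+ n)
  period-+ {m} {n} pm pn b = begin
    f (b + + (m ℕ.+ n)) ≡⟨ cong f (pos-+-assoc b m n) ⟨
    f ((b + + m) + + n) ≡⟨ pn (b + + m) ⟩
    f (b + + m)         ≡⟨ pm b ⟩
    f b                 ∎
    where open ≡-Reasoning

  period-* : ∀ {m} → Period f m → ∀ k → Period f (k ℕ.* m)
  period-* pm zero    b = cong f (ℤ.+-identityʳ b)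
  period-* pm (suc k) = period-+ pm (period-* pm k)

  period-cancelʳ : ∀ {m n} → Period f (m ℕ.+ n) → Period f n → Period f m
  period-cancelʳ {m} {n} pmn pn b = begin
    f (b + + m)         ≡⟨ pn (b + + m) ⟨
    f ((b + + m) + + n) ≡⟨ cong f (pos-+-assoc b m n) ⟩
    f (b + + (m ℕ.+ n)) ≡⟨ pmn b ⟩
    f b                 ∎
    where open ≡-Reasoning

  period-gcd : ∀ {m n} → Period f m → Period f n → Period f (gcd m n)
  period-gcd {m} {n} pm pn with Bézout.identity (gcd-GCD m n)
  ... | Bézout.+- x y d+yn≡xm = period-cancelʳ (subst (Period f) (sym d+yn≡xm) (period-* pm x)) (period-* pn y)
  ... | Bézout.-+ x y d+xm≡yn = period-cancelʳ (subst (Period f) (sym d+xm≡yn) (period-* pn y)) (period-* pm x)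

prime-divisor : ∀ n .{{_ : NonTrivial n}} → ∃[ p ] Prime p × p ℕ.∣ n
prime-divisor n with factorise n {{ℕ.nonTrivial⇒nonZero n}}
... | record { factors = [] ; isFactorisation = n≡1 } = contradiction n≡1 ℕ.nonTrivial⇒≢1
... | record { factors = p ∷ ps ; isFactorisation = n≡p*ps ; factorsPrime = p-prime All.∷ _ } =
  p , p-prime , divides (product ps) (trans n≡p*ps (*-comm p (product ps)))

-- gcd M N is again a period; were it a proper divisor of N, it would divide some
-- N / p with p prime, which is then a period too.
period-least : ∀ {a} {A : Set a} {f : ℤ → A} {N} .{{_ : NonZero N}} → Period f N →
               (∀ {p k} → Prime p → N ≡ k ℕ.* p → ¬ Period f k) →
               ∀ {M} .{{_ : NonZero M}} → Period f M → N ≤ M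
period-least {f = f} {N} pN not-cofactor {M} pM with gcd[m,n]∣n M N
... | divides zero     N≡0*d = contradiction N≡0*d (≢-nonZero⁻¹ N)
... | divides 1        N≡1*d = subst (_≤ M) (sym (trans N≡1*d (*-identityˡ _))) (∣⇒≤ (gcd[m,n]∣m M N))
... | divides c@(2+ _) N≡c*d with prime-divisor c
...   | p , p-prime , divides k c≡k*p =
  contradiction (period-* (period-gcd pM pN) k) (not-cofactor p-prime N≡[k*d]*p)
  where
  d = gcd M N
  N≡[k*d]*p : N ≡ (k ℕ.* d) ℕ.* p
  N≡[k*d]*p = trans N≡c*d (trans (cong (ℕ._* d) c≡k*p) (rearrange k p d))
    where
    rearrange : ∀ k p d → k ℕ.* p ℕ.* d ≡ k ℕ.* d ℕ.* p
    rearrange = ℕ-Solver.solve-∀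

-- The primary pretender

-- Evaluating N itself runs the trial-division search for its primes, and Agda
-- does not share that value between uses, so computations use its digits.
Nᵥ : ℕ
Nᵥ = 19568584333460072587245340037736278982017213829337604336734362294738647777395483196097971852999259921329236506842360439300

N≡Nᵥ : N ≡ Nᵥ
N≡Nᵥ = refl

values : List ℕ
values =
  4 ∷ 6 ∷ 9 ∷ 10 ∷ 14 ∷ 15 ∷ 21 ∷ 22 ∷ 25 ∷ 26 ∷ 33 ∷ 34 ∷ 38 ∷ 39 ∷ 46 ∷ 49 ∷ 51 ∷ 57 ∷ 58 ∷ 62 ∷
  65 ∷ 69 ∷ 74 ∷ 82 ∷ 85 ∷ 86 ∷ 87 ∷ 91 ∷ 93 ∷ 94 ∷ 106 ∷ 111 ∷ 118 ∷ 121 ∷ 122 ∷ 123 ∷ 129 ∷ 133 ∷ 134 ∷ 141 ∷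
  142 ∷ 145 ∷ 146 ∷ 158 ∷ 159 ∷ 166 ∷ 169 ∷ 177 ∷ 178 ∷ 183 ∷ 185 ∷ 194 ∷ 201 ∷ 202 ∷ 205 ∷ 206 ∷ 213 ∷ 214 ∷ 217 ∷ 218 ∷
  219 ∷ 226 ∷ 237 ∷ 249 ∷ 254 ∷ 259 ∷ 262 ∷ 265 ∷ 267 ∷ 274 ∷ 278 ∷ 289 ∷ 291 ∷ 298 ∷ 301 ∷ 302 ∷ 303 ∷ 305 ∷ 309 ∷ 314 ∷
  321 ∷ 326 ∷ 327 ∷ 334 ∷ 339 ∷ 341 ∷ 346 ∷ 358 ∷ 361 ∷ 362 ∷ 365 ∷ 381 ∷ 382 ∷ 386 ∷ 393 ∷ 394 ∷ 398 ∷ 411 ∷ 417 ∷ 422 ∷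
  427 ∷ 445 ∷ 446 ∷ 447 ∷ 451 ∷ 453 ∷ 454 ∷ 458 ∷ 466 ∷ 469 ∷ 471 ∷ 478 ∷ 481 ∷ 482 ∷ 485 ∷ 489 ∷ 501 ∷ 502 ∷ 505 ∷ 511 ∷
  514 ∷ 519 ∷ 526 ∷ 529 ∷ 537 ∷ 538 ∷ 542 ∷ 543 ∷ 545 ∷ 553 ∷ 554 ∷ 561 ∷ []

values-increasing : AllPairs _<_ values
values-increasing = decide (allPairs? _<?_ values) refl

values-unique : Unique values
values-unique = AllPairs.map <⇒≢ values-increasing

values-composite : All Composite values
values-composite = decide (all? composite? values) refl

values-divide-N : All (ℕ._∣ N) values
values-divide-N = subst (λ n → All (ℕ._∣ n) values) (sym N≡Nᵥ) (decide (all? (ℕ._∣? Nᵥ) values) refl)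

561∈values : 561 ∈ values
561∈values = decide (561 ∈? values) refl

fermat-561 : ∀ b → Fermat 561 b
fermat-561 b = fermat-≡mod ℕ.∣-refl (%ℕ-≡mod b) (fermat-residues (n%ℕd<d b 561))
  where
  fermat-residues : ∀ {s} → s < 561 → Fermat 561 (+ s)
  fermat-residues = decide (allBelow? (λ s → fermat? 561 (+ s)) 561) refl

-- The implicit arguments are given: inferring them would unfold b ^ 561.
561-pretender : ∀ b → PrimePretender b 561
561-pretender b = All.lookup values-composite 561∈values , Equivalence.to (fermat⇔∣ {561} {b}) (fermat-561 b)

composite-listed-or-dominated : ∀ {q} → q < 562 → Composite q →
                                q ∈ values ⊎ Any (λ v → v < q × Dominates v q) values
composite-listed-or-dominated = decide (allBelow?
  (λ q → composite? q →-dec (q ∈? values ⊎-dec any? (λ v → v <? q ×-dec dominates? v q) values))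
  562) refl

-- The default 561 is never returned: 561 ∈ values and every b satisfies Fermat 561 b.
primaryPretender : ℤ → ℕ
primaryPretender b = fromMaybe 561 (find (λ v → fermat? v b) values)

primaryPretender-least : ∀ b {v} → v ∈ values → Fermat v b →
  primaryPretender b ∈ values × Fermat (primaryPretender b) b × primaryPretender b ≤ v
primaryPretender-least b = find-least (λ v → fermat? v b) 561 (AllPairs.map <⇒≤ values-increasing)

primaryPretender-∈ : ∀ b → primaryPretender b ∈ values
primaryPretender-∈ b = proj₁ (primaryPretender-least b 561∈values (fermat-561 b))

primaryPretender-fermat : ∀ b → Fermat (primaryPretender b) b
primaryPretender-fermat b = proj₁ (proj₂ (primaryPretender-least b 561∈values (fermat-561 b)))

primaryPretender-≤ : ∀ b {v} → v ∈ values → Fermat v b → primaryPretender b ≤ v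
primaryPretender-≤ b v∈values v-fermat = proj₂ (proj₂ (primaryPretender-least b v∈values v-fermat))

primaryPretender≤561 : ∀ b → primaryPretender b ≤ 561
primaryPretender≤561 b = primaryPretender-≤ b 561∈values (fermat-561 b)

primaryPretender-pretender : ∀ b → PrimePretender b (primaryPretender b)
primaryPretender-pretender b =
  All.lookup values-composite (primaryPretender-∈ b) , Equivalence.to fermat⇔∣ (primaryPretender-fermat b)

primaryPretender-≤-composite : ∀ b {q} → Composite q → Fermat q b → primaryPretender b ≤ q
primaryPretender-≤-composite b {q} q-composite q-fermat = case q <? 562 of λ where
    (yes q<562) → [ listed , dominated ]′ (composite-listed-or-dominated q<562 q-composite)
    (no q≮562)  → ≤-trans (primaryPretender≤561 b) (<⇒≤ (≮⇒≥ q≮562))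
  where
  instance _ = composite⇒nonZero q-composite
  listed : q ∈ values → primaryPretender b ≤ q
  listed q∈values = primaryPretender-≤ b q∈values q-fermat
  dominated : Any (λ v → v < q × Dominates v q) values → primaryPretender b ≤ q
  dominated v-dominates = let v , v∈values , v<q , v-dominates-q = find-∈ v-dominates in
    ≤-trans (primaryPretender-≤ b v∈values
              (dominates⇒fermat {{composite⇒nonZero (All.lookup values-composite v∈values)}} v-dominates-q q-fermat))
            (<⇒≤ v<q)

primaryPretender-minimal : ∀ b q → PrimePretender b q → primaryPretender b ≤ q
primaryPretender-minimal b q (q-composite , q∣b^q-b) =
  primaryPretender-≤-composite b q-composite (Equivalence.from fermat⇔∣ q∣b^q-b)

primaryPretender-period : Period primaryPretender N
primaryPretender-period b =
  cong (fromMaybe 561) $ find-cong (λ v → fermat? v (b + + N)) (λ v → fermat? v b) λ v∈values →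
    let v∣N = All.lookup values-divide-N v∈values in
    mk⇔ (fermat-≡mod ℕ.∣-refl (+-multiple-≡mod v∣N b))
        (fermat-≡mod ℕ.∣-refl (≡mod-sym (+-multiple-≡mod v∣N b)))

witnesses : List ℤ
witnesses =
  + 0 ∷
  + 9784292166730036293622670018868139491008606914668802168367181147369323888697741598048985926499629960664618253421180219650 ∷
  + 1087143574081115143735852224318682165667622990518755796485242349707702654299749066449887325166625551184957583713464468850 ∷
  + 7610005018567806006150965570230775159673360933631290575396696447953918580098243465149211276166378858294703085994251281950 ∷
  + 565314658522179874742643156645714726147163955069753014172326021848005380235869514553941409086645286616177943531001523802 ∷
  + 8296902264558649370437944853188048625980903949681508523543290389728418053100697161012242124883903900431157918479330056554 ∷
  + 5756979889848321581562835411555339762192547215914423552489605814329687443626507913518709451719102000438220282081015517902 ∷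
  + 15341592624604275501846267266773109059507100928243046084767660815834331252963071111607511991963637472109683060942579814702 ∷
  + 15276903089617630633789257878218608963698779560212177971257795155355856384277466208479915390796697769890412857614175317382 ∷
  + 3535752489541587081442053855576841574488451262609615369217177778512667717840176290821132278997141817092870953508759053802 ∷
  + 9112832517680141682570023034506228532637814175093333794298495371242720006297356400697359965401351647476106826259371633402 ∷
  + 17199024391010750189696196603818740508677985178951847983031702931052078591997969291646935111268814424884882242309933798402 ∷
  + 2031678748467302924841676989794773408429348854482562960787768142050496923705276433771690491643090472020698929048035049602 ∷
  + 2318749229518406286076651818652384083721607478247206798276946037996850572523794315731855136341976499157509345111630791102 ∷
  + 12276727056012881093787298228388005340842793213886461076141769454254387311316762095994728386980653145514398928475198825302 ∷
  + 16626643453119356085018641513656183246571090196435100256276154529763977546776535028208628846723013998363404011320215639902 ∷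
  + 7499427894719258673906751749568327680140492262477408239883917896987424438260387403731042229318867978987681454460262903402 ∷
  + 19513974851747361594245298616855442003033576944955149287814211264981789220641773941760311052406097745023436081129620396902 ∷
  + 15827925725223026591661688859054702471794877387074381711919649946305257229331821428367895301702636042390782113081751948502 ∷
  + 11104474334387836656809365401670083407170032669648063423742390082057997420994980656895971061323504337242345714878423566602 ∷
  + 1930883358442439009496031724884379803460493222262463833931434976908518714890131118889363145506328852076358911899832759402 ∷
  + 16947962198340149325858723909188502711697034079628321270988452168608101583804034941382328044318648909152173824763601874502 ∷
  + 1004559839698766934360157640257810384193406177086719249944009542838050181048924813748630750098079861717578485540431081802 ∷
  + 11053292335259344749432089010987250942526570035395218774213006396893031472143902671204346025962564686183943178243264820902 ∷
  + 8295292855397894735025833811137509538191288822213195038678667209433031321223955254757083557019298244406592771759448301902 ∷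
  + 3894054164481269412635013387425197656422711317344875724188239703695965212121164916534356323645762275941539578178986611402 ∷
  + 13482189711990575227235576950421882867338924348399628129757361886603193593828173924405936758435295404997003496126606682302 ∷
  + 3444356409742335585461493119597764246487817315762464836031553519132685429704067669561965887502804190505736289801021262102 ∷
  + 11762592201041358615008233387595224313857990096433364789821861751692900852544254933870074938205104599896881489407422617002 ∷
  + 16181304792467826618579761783213093761410264186928952865858653237601627770020654365247036324366227807938967152242794329102 ∷
  + 15764951934309101669914967314325087825622663892687727241672815741968890583267558978096015646642839298974515311671680277202 ∷
  + 11214582502357141904599375750221190214301985919114067079739685091076068866545304853965125710402317869027482243277944244402 ∷
  + 16503389078967972333584602787447211560793124791908014197775999224789216914490030042099712697699415145062411028911014633402 ∷
  + 16404710127293429314514588465923397855322804061013469617845695674906797623274700528854226356936286785744880210274465400202 ∷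
  + 12523338028094737231094025152653392106823521979161382807253756046198305502138406341198430286919904652588668010570195561002 ∷
  + 3854009183043253653857784944012129766929450438615175048316661514982623080165517344286573904223711132863440481749189816602 ∷
  + 13821444651816450014235728990459763644326760715838753434242615763805825408073142931408513055666329062162166734241781804402 ∷
  + 18727772695740086071026224605152129668807273260049405761664514755696749659160124867839184089092414201234085080220681941602 ∷
  + 2899444093606176942284841527537189328782269276208462641646692622556347578829152310330575277248137478164453335073952722002 ∷
  + 6298623398275170179891447116816879580660140335162946468954947997348992969186513157668012750601772021501097466303794309902 ∷
  + 15458386277767119050516925432353010167987346808469910201043372901269211077754611674990467660516319218719037958868303451702 ∷
  + 1763228422246980828943086192732816863914104881284146311177313616801803866862483804384747679859722061538158985405534441002 ∷
  + 5811901042962857915959363441919633205021114639078133415329250643299455131151204465646397028756120665951104469579815911202 ∷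
  + 8492529033847799366266944269006794709407034341727120310772313971345845237643736410317352077112183668872917689695207752202 ∷
  + 2678504932862767052311080164171845807178848527612962251326995916735174629790862969680648713097118146509991915988043580602 ∷
  + 3786160649851073047815533373855031409934539876443392685481771140965664126624569565686194289681981915641835491847045114902 ∷
  + 6048956956179741881957683622747042852782755519929925389137801342866718286098118702641417098947313033656808159851487164702 ∷
  + 13292728370762143639005376941299304985229404426166521277903876082599979638657212923561847758802921134110745773606893080002 ∷
  + 7322651794452290985269510489108575804275000207046574192120511314713612520129777372209924142633655395400131246095664471402 ∷
  + 19339903621263099975115884349085137625244864069085913455092027964309974960696463866184991034860498751029468971977489799202 ∷
  + 5432943377191342584800631615133435592832098901935927918485064242218352880527055338696667219082557716996639837296432579602 ∷
  + 4904062719530259541902108911410833458182985014656533206681432828847038075732582819883208520352847989393146958733125540702 ∷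
  + 2709033025870866879015225869787545663462174292762839782850174156302881400902407831430304768877780981753661897417833840402 ∷
  + 11763154135382243747740681708143137431261183676486208953578013427002852760592855280371157417280423631920920579688179715302 ∷
  + 18383677354695830247313422928348046113658217382089199457264282824474199183227743461422415221205070613273796780143660752602 ∷
  + 14088134452228985045235177554210814141995902151258993627249422808555959427214100808620421399814989167128354620105093826902 ∷
  + 10604161144124921800521184291646526539837224125032060652214807779463969900868015874760232783295771825740324272517407064702 ∷
  + 5918725458648566392307511324864600586396482785613197642010805539878659869660646658793112762155103957253042292005855973602 ∷
  + 5399570975276698322461991299745278141290207592070324810647337381320625198448466218257501811578096157109245845638015238402 ∷
  + 980858383850230318890462904127408693737933501574736734610545895411898280972066786880540425416972949067160182802643526302 ∷
  + 6654444415934230250871737186778859694305196578649243861020772590644028533887911921152002165377924644242043759689073780602 ∷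
  + 10675386402261642426333108427409601950884076132622724204185367582713613693626709838158434737912019148624763589862161542102 ∷
  + 1023714304107200889238761817557150247308206020538768575794934381892031284769051888968407845478307774858366329906195034402 ∷
  + 8228009344670357092626019839685467688605987656046009214635372170438484805377973108334048237904754846703535908603382483002 ∷
  + 3748453894842147705184315493697644789108071237281979306226301283691083506938043220070657090832635105676361286555131298102 ∷
  + 10507298834873153836084333983003024824820762883380070780693181471893004201280003047111944240740657845050132482683062984202 ∷
  + 9449537519550987750287288575557820555522535108821281357085918645150374591691058009485026843281238389843146725556448906402 ∷
  + 14663692930310189001389676458290373647375026191101933528043511939874052884674155217144719761047136539700425644994496841402 ∷
  + 753694357045057904286936338186548456214602623205179798751521951691164184736259275546988231874671304123378791604114277702 ∷
  + 6910102911392047032858503990508074428085186749288920488960085370260626406838209045105900724953090155777520613981486101302 ∷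
  + 2196502305522102541040283397476707957964252031273293166972976204374674752429078056264783417296334116333251966347924827602 ∷
  + 8953511921648777676279140076758775264219032171840914330370510231168127325684728834514639471986352646336434351312460976902 ∷
  + 12884261337755283178322393019807788461084830733286355418379328198623388112418719698040757957494105388354945776062909792002 ∷
  + 3604314128073186899834912177169965438684914896693264701989836801118462362313645192674709449886208930817369700653130614602 ∷
  + 4144916504696010818664696036492475409001294926003824397260943735123260342116829292207929524489122775998464575276370476902 ∷
  + 18707583915643041581265879320389241163060616845510878787388841256789230781108816786978513229046711554662082440833475920102 ∷
  + 10036382491111983254296893157185400538808283814321872813508386179230789912992714535373366433258304332293517736011452980702 ∷
  + 9353498928103719075387990688736561067759152021868117752252439434648934812823906081037858569535720192854175770588452251202 ∷
  + 15993674290022686886307466251438096447300883660280941633506245007207075360557022454439239437050350489253019035364500708402 ∷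
  + 13523852966382095200538636926286915604910361526481049824015500251560449912924582827747262407060152635104668796636824148102 ∷
  + 13265252709103201450055366166814479511451952009836431206076633150576344918187884377272010918795027585843695494385558952702 ∷
  + 15642744263635733633552463554576831163472734998447542013343424831245526423852756167452138340187461034229490584001920501402 ∷
  + 17308061960049963934217457877594631232184955818504865014251983157898581832161529206935457608591518050104416322637911326202 ∷
  + 12281269654207009508136086124781642135886955935739241881879853394112507173748010587754327224334827428111584926384827910602 ∷
  + 7672992998073441463108356214988837101915014954467644527608881742487338887873095250810901496247883912114174771310510185402 ∷
  + 16851178570404271968630506852157180341268221440794131517404644588692191385235578519777206878628067769020807823192325258702 ∷
  + 11801221323059737107405902971451043829779908194513459430505454319082217765262550598203536723015355531258424208523329016302 ∷
  + 3996410230523638792261807811891487472790383603621582556316604617712468073700190248314750261414494637780289416776954043402 ∷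
  + 9275649009910652602649588694880338298298455357855514625867203325278026914030982407858784420304853482834106096449850088502 ∷
  + 13070111346038644517073892857322276051044175490968069483405722329797986316850051171645094751911358176720661651793244079502 ∷
  + 14684412180328471136319894570872003144845640947259448332042705217958519585400802453242520720258379543121090607553341928502 ∷
  + 1977813357393551820688684666096639163425769600844565567816531017297678293207855754880985766633576962342101957872508162502 ∷
  + 745146627726775594720474270018763322038858493484716475738775912117291031639636340953554468806851927927661862953304355302 ∷
  + 11195385381721159908327933347762744767932867973026264341429377765852066284489580246723152002869283927799819578649224589902 ∷
  + 8464777244694417192360620938114617874425106615991772069942654268805119744970881329829047478193359828505845509269014661102 ∷
  + 14439917499186042409840114079408138174277690991362032936121085503839821356389349481309344227200767438072024595327750673102 ∷
  + 18611899945913570575648765254966126586687452315383248073902015536220649816544731685553581881139695949218359282065715842902 ∷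
  + 14226320579099902105265130745536912465713048306387438276834673218029213147070117654516696431195615029315133846244022621902 ∷
  + 14828494103198395122968526705318116030459258845902842159695899721453928139327312064689117347325298709087172526757052250502 ∷
  + 16940211837025021661160469874858002251540253144032799462221190616569609554154162769304006396210110930813349128214860931002 ∷
  + 3238705970103867581737347784882138201665408063620206013176821647555182254807717694077922771066040508078590414854333211402 ∷
  + 17472697411038446076309432479857375943420054851620611156990414703720759722653502026623675367767841471300022532283045934702 ∷
  + 17032953942870803995697177647548695516857870271186058250546945888108655278217648471655181618262240124753298116398947947302 ∷
  + 19518853797553290118150681734564821967728988926906828344306711838874352821432092585500233509540714742622221199896754051202 ∷
  + 5661643807939887922632046769227263795162862388076499917278908387075467523508887428138991696465776386153031949839453141002 ∷
  + 1027894069149310243274645946206526436474890255333982075629324293377057308412492925557885778763157254402319509356348569202 ∷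
  + 12820881978717963259429122392789317081266721106126842967303675080272533783531625182808981398782578796395435549903731350502 ∷
  + 2303845464699774468046164310834136306790509268333064425094017811734582114623039500324608861047293728544480246666868030702 ∷
  + 16916194464794413823587444426348999651440917848318786440734087472871301633988225642389033257828400482026137201557888271402 ∷
  + 6775277979130972197117980528758422688753116946432858628026317889600808999363316344046032022112302040955512427978060204402 ∷
  + 10168480548218449371672168210936478859795934516992017322788507910097366994036703676461917625294225236744515887287924777202 ∷
  + 3562525327368870727570238134503212706630887810272953438413213632255657871731222087970245598485557874767130314914389087502 ∷
  + 384815601840355038857775362345653437358387633983368475442440788735958877233889297107790822854331226906813270492176083902 ∷
  + 9375786782078766768132661325629889726393323717733078576104174816048310558739922116936588701259396596166192206068395745202 ∷
  + 10491623840576532809917237544575967490136701654786893290604192138154937477817142423237593812267995367399963531029719544902 ∷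
  + 5648674596579994701392095835154548246785025118565399029036830196512262836557985776198737075768969115286795328431898003002 ∷
  + 3535891474871051116148568618266596888343065181589416546921467396312531532867257106666686847049788155410720750216193314302 ∷
  + 606462682436908513267529690461764705406356524502948831841473040812733961400867406652020401990018706109936842006259116802 ∷
  + 16533195377489635336376405119384199490462613592891682620640340826199603102302646617929266003462691577270290944238061528702 ∷
  + 15275158082757494497321164216374977160681498801747504612283893284126346755295260338945075218392618445205994442916580605302 ∷
  + 7233274110102670146398421735113492647523739693800543925954703299987176435817664504932210073324429436440554782570405082302 ∷
  + 16770433731383035250490081240696080292006117653538663814681832617022145480337192301793435688642145260090117902310561812002 ∷
  + 14847509259308924071396608520224885247530437681869650671765739212336844831691393375009241922740483880537533968112179572302 ∷
  + 2456149485911244721854627366426352669118378763393628012886006422841059466228437413240245090512506566219073805697226958202 ∷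
  + 11170060280017098717628111731690083536420845083612544535710151489636740388192065893736459948878843323067861827235862840002 ∷
  + 14996319786559571011223569280968126912792925999963472757976646910395693864219115680682990758124508670813801926339117674502 ∷
  + 14414354453222468480747871435979687389164161276414399023055178886760343744445272314256285275507430308841185227250869036902 ∷
  + 5101414193486847708966353875870501102315578380407038609674677910054894442381702565837067421918008612983614596362037777702 ∷
  + 19467645400635496467325191379371553602469530689400188856177820668278553746340148438019287722938905804961548681470494800502 ∷
  + 5687144251163672037055101727898693801406659401384484211193826596127217069749019637515501714741540555520079609644682037302 ∷
  + 6182551449479116912681566032651510990824816713519613434908620578272499291961563515897728850260509161123351419944488630702 ∷
  + 14518627086115537726020736157030142470528900583056932249835172025128674157422455274524301697386547683566852892173364196902 ∷
  []

witnesses-attain : map primaryPretender witnesses ≡ values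
witnesses-attain = refl

values-attained : ∀ v → v ∈ values → ∃[ b ] primaryPretender b ≡ v
values-attained v v∈values =
  let b , _ , v≡b = ∈-map⁻ primaryPretender {xs = witnesses} (subst (v ∈_) (sym witnesses-attain) v∈values)
  in b , sym v≡b

-- The least period

primesBelow : ℕ → List ℕ
primesBelow n = filter prime? (upTo n)

primeFactors-N : List ℕ
primeFactors-N = primesBelow 278 ++ primesBelow 24

N-factorisation : N ≡ product primeFactors-N
N-factorisation = N≡Nᵥ

cofactor : ℕ → ℕ
cofactor zero        = 0
cofactor p@(suc _) = Nᵥ / p

cofactor-correct : ∀ {p k} .{{_ : NonZero p}} → N ≡ k ℕ.* p → cofactor p ≡ k
cofactor-correct {p@(suc _)} {k} N≡k*p = trans (cong (_/ p) (trans (sym N≡Nᵥ) N≡k*p)) (m*n/n≡m k p)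

periodBreakers : List (ℕ × ℤ)
periodBreakers =
  (2 , + 0) ∷
  (3 , + 1087143574081115143735852224318682165667622990518755796485242349707702654299749066449887325166625551184957583713464468850) ∷
  (5 , + 15276903089617630633789257878218608963698779560212177971257795155355856384277466208479915390796697769890412857614175317382) ∷
  (7 , + 16626643453119356085018641513656183246571090196435100256276154529763977546776535028208628846723013998363404011320215639902) ∷
  (11 , + 16404710127293429314514588465923397855322804061013469617845695674906797623274700528854226356936286785744880210274465400202) ∷
  (13 , + 6048956956179741881957683622747042852782755519929925389137801342866718286098118702641417098947313033656808159851487164702) ∷
  (17 , + 8953511921648777676279140076758775264219032171840914330370510231168127325684728834514639471986352646336434351312460976902) ∷
  (19 , + 9275649009910652602649588694880338298298455357855514625867203325278026914030982407858784420304853482834106096449850088502) ∷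
  (23 , + 2456149485911244721854627366426352669118378763393628012886006422841059466228437413240245090512506566219073805697226958202) ∷
  (29 , + 15827925725223026591661688859054702471794877387074381711919649946305257229331821428367895301702636042390782113081751948502) ∷
  (31 , + 11104474334387836656809365401670083407170032669648063423742390082057997420994980656895971061323504337242345714878423566602) ∷
  (37 , + 1004559839698766934360157640257810384193406177086719249944009542838050181048924813748630750098079861717578485540431081802) ∷
  (41 , + 11053292335259344749432089010987250942526570035395218774213006396893031472143902671204346025962564686183943178243264820902) ∷
  (43 , + 3894054164481269412635013387425197656422711317344875724188239703695965212121164916534356323645762275941539578178986611402) ∷
  (47 , + 16181304792467826618579761783213093761410264186928952865858653237601627770020654365247036324366227807938967152242794329102) ∷
  (53 , + 16134170506638537001749785050886149693207894342297870719724407483379053748878794510097864172171127222018463170291347455302) ∷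
  (59 , + 16503389078967972333584602787447211560793124791908014197775999224789216914490030042099712697699415145062411028911014633402) ∷
  (61 , + 12523338028094737231094025152653392106823521979161382807253756046198305502138406341198430286919904652588668010570195561002) ∷
  (67 , + 2899444093606176942284841527537189328782269276208462641646692622556347578829152310330575277248137478164453335073952722002) ∷
  (71 , + 15458386277767119050516925432353010167987346808469910201043372901269211077754611674990467660516319218719037958868303451702) ∷
  (73 , + 5811901042962857915959363441919633205021114639078133415329250643299455131151204465646397028756120665951104469579815911202) ∷
  (79 , + 8492529033847799366266944269006794709407034341727120310772313971345845237643736410317352077112183668872917689695207752202) ∷
  (83 , + 3786160649851073047815533373855031409934539876443392685481771140965664126624569565686194289681981915641835491847045114902) ∷
  (89 , + 7322651794452290985269510489108575804275000207046574192120511314713612520129777372209924142633655395400131246095664471402) ∷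
  (97 , + 4904062719530259541902108911410833458182985014656533206681432828847038075732582819883208520352847989393146958733125540702) ∷
  (101 , + 11763154135382243747740681708143137431261183676486208953578013427002852760592855280371157417280423631920920579688179715302) ∷
  (103 , + 14088134452228985045235177554210814141995902151258993627249422808555959427214100808620421399814989167128354620105093826902) ∷
  (107 , + 5918725458648566392307511324864600586396482785613197642010805539878659869660646658793112762155103957253042292005855973602) ∷
  (109 , + 980858383850230318890462904127408693737933501574736734610545895411898280972066786880540425416972949067160182802643526302) ∷
  (113 , + 10675386402261642426333108427409601950884076132622724204185367582713613693626709838158434737912019148624763589862161542102) ∷
  (127 , + 3748453894842147705184315493697644789108071237281979306226301283691083506938043220070657090832635105676361286555131298102) ∷
  (131 , + 9449537519550987750287288575557820555522535108821281357085918645150374591691058009485026843281238389843146725556448906402) ∷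
  (137 , + 6910102911392047032858503990508074428085186749288920488960085370260626406838209045105900724953090155777520613981486101302) ∷
  (139 , + 2196502305522102541040283397476707957964252031273293166972976204374674752429078056264783417296334116333251966347924827602) ∷
  (149 , + 3604314128073186899834912177169965438684914896693264701989836801118462362313645192674709449886208930817369700653130614602) ∷
  (151 , + 18707583915643041581265879320389241163060616845510878787388841256789230781108816786978513229046711554662082440833475920102) ∷
  (157 , + 13523852966382095200538636926286915604910361526481049824015500251560449912924582827747262407060152635104668796636824148102) ∷
  (163 , + 15642744263635733633552463554576831163472734998447542013343424831245526423852756167452138340187461034229490584001920501402) ∷
  (167 , + 12281269654207009508136086124781642135886955935739241881879853394112507173748010587754327224334827428111584926384827910602) ∷
  (173 , + 11801221323059737107405902971451043829779908194513459430505454319082217765262550598203536723015355531258424208523329016302) ∷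
  (179 , + 3996410230523638792261807811891487472790383603621582556316604617712468073700190248314750261414494637780289416776954043402) ∷
  (181 , + 13070111346038644517073892857322276051044175490968069483405722329797986316850051171645094751911358176720661651793244079502) ∷
  (191 , + 745146627726775594720474270018763322038858493484716475738775912117291031639636340953554468806851927927661862953304355302) ∷
  (193 , + 11195385381721159908327933347762744767932867973026264341429377765852066284489580246723152002869283927799819578649224589902) ∷
  (197 , + 14439917499186042409840114079408138174277690991362032936121085503839821356389349481309344227200767438072024595327750673102) ∷
  (199 , + 18611899945913570575648765254966126586687452315383248073902015536220649816544731685553581881139695949218359282065715842902) ∷
  (211 , + 16940211837025021661160469874858002251540253144032799462221190616569609554154162769304006396210110930813349128214860931002) ∷
  (223 , + 17032953942870803995697177647548695516857870271186058250546945888108655278217648471655181618262240124753298116398947947302) ∷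
  (227 , + 12820881978717963259429122392789317081266721106126842967303675080272533783531625182808981398782578796395435549903731350502) ∷
  (229 , + 2303845464699774468046164310834136306790509268333064425094017811734582114623039500324608861047293728544480246666868030702) ∷
  (233 , + 16916194464794413823587444426348999651440917848318786440734087472871301633988225642389033257828400482026137201557888271402) ∷
  (239 , + 3562525327368870727570238134503212706630887810272953438413213632255657871731222087970245598485557874767130314914389087502) ∷
  (241 , + 9375786782078766768132661325629889726393323717733078576104174816048310558739922116936588701259396596166192206068395745202) ∷
  (251 , + 606462682436908513267529690461764705406356524502948831841473040812733961400867406652020401990018706109936842006259116802) ∷
  (257 , + 7233274110102670146398421735113492647523739693800543925954703299987176435817664504932210073324429436440554782570405082302) ∷
  (263 , + 14921914522934247541310088900596506080161681840916561714871193061366269347955254527846116340432496275675667947225648623402) ∷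
  (269 , + 14996319786559571011223569280968126912792925999963472757976646910395693864219115680682990758124508670813801926339117674502) ∷
  (271 , + 14414354453222468480747871435979687389164161276414399023055178886760343744445272314256285275507430308841185227250869036902) ∷
  (277 , + 6182551449479116912681566032651510990824816713519613434908620578272499291961563515897728850260509161123351419944488630702) ∷
  []

-- The component p ≡ p′ only directs the search to the entry listed for p.
BreaksCofactor : ℕ → ℕ × ℤ → Set
BreaksCofactor p (p′ , b) = p ≡ p′ × primaryPretender (b + + cofactor p) ≢ primaryPretender b

breaksCofactor? : ∀ p x → Dec (BreaksCofactor p x)
breaksCofactor? p (p′ , b) = p ≟ p′ ×-dec ¬? (primaryPretender (b + + cofactor p) ≟ primaryPretender b)

cofactors-broken : All (λ p → Any (BreaksCofactor p) periodBreakers) primeFactors-N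
cofactors-broken = decide (all? (λ p → any? (breaksCofactor? p) periodBreakers) primeFactors-N) refl

primeFactors-N-prime : All Prime primeFactors-N
primeFactors-N-prime = ++⁺ (all-filter prime? (upTo 278)) (all-filter prime? (upTo 24))

∈-primeFactors-N : ∀ {p} → Prime p → p ℕ.∣ N → p ∈ primeFactors-N
∈-primeFactors-N {p} p-prime p∣N = factorisationHasAllPrimeFactors {as = primeFactors-N} p-prime
  (subst (p ℕ.∣_) N-factorisation p∣N) primeFactors-N-prime

no-cofactor-period : ∀ {p k} → Prime p → N ≡ k ℕ.* p → ¬ Period primaryPretender k
no-cofactor-period {p} {k} p-prime N≡k*p period =
  refute (find-∈ (All.lookup cofactors-broken (∈-primeFactors-N p-prime (divides k N≡k*p))))
  where
  refute : ¬ (∃[ x ] x ∈ periodBreakers × BreaksCofactor p x)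
  refute ((_ , b) , _ , _ , shift-changes) = shift-changes $
    subst (λ c → primaryPretender (b + + c) ≡ primaryPretender b)
          (sym (cofactor-correct {{prime⇒nonZero p-prime}} N≡k*p)) (period b)

N-nonZero : NonZero N
N-nonZero = subst NonZero (sym N≡Nᵥ) _

primaryPretender-least-period : ∀ {M} .{{_ : NonZero M}} → Period primaryPretender M → N ≤ M
primaryPretender-least-period =
  period-least {f = primaryPretender} {N = N} {{N-nonZero}} primaryPretender-period no-cofactor-period

mainTheorem1 : (∀ b → PrimePretender b 561)
    × Σ (ℤ → ℕ) (λ qf →
        (∀ b → IsPrimaryPretender b (qf b) × qf b ≤ 561)
        × Σ (List ℕ) (λ vals →
            Unique vals × length vals ≡ 132
            × (∀ b → qf b ∈ vals)
            × (∀ v → v ∈ vals → ∃[ b ] qf b ≡ v))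
        × (∀ b → qf (b + + N) ≡ qf b)
        × (∀ M → 0 < M → (∀ b → qf (b + + M) ≡ qf b) → N ≤ M))
mainTheorem1 =
    561-pretender
  , primaryPretender
  , (λ b → (primaryPretender-pretender b , primaryPretender-minimal b) , primaryPretender≤561 b)
  , (values , values-unique , refl , primaryPretender-∈ , values-attained)
  , primaryPretender-period
  , λ M M>0 → primaryPretender-least-period {{>-nonZero M>0}}
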